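{- Let $B$ be a nontrivial Boolean algebra and $f$ a modal operator on $B$. The following are equivalent: (a) $f$ has no proper companion; (b) for every $x\in B\setminus\{0\}$, $\prod\{f(y):0< y\le x\}$ exists in $B$ and equals $0$; (c) for every $u\in B\setminus\{1\}$, $\sum\{f^\partial(y): u\le y< 1\}$ exists in $B$ and equals $1$.
   Context: A modal operator on $B$ is $f:B\to B$ with $f(0)=0$, $f(x+y)=f(x)+f(y)$; its dual is $f^\partial(x)=-f(-x)$. A companion of $f$ is a modal operator $g$ with $f(x)+g(x)=1$ for all $x\neq0$; it is proper if $g$ is not the unary discriminator (the map sending $0$ to $0$ and every nonzero element to $1$). -}

module Defs where

open import Level using (Level; _⊔_)
open import Algebra.Lattice.Bundles using (BooleanAlgebra)
open import Data.Product using (Σ; _×_; ∃)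
open import Relation.Nullary using (¬_)

module _ {c ℓ : Level} (B : BooleanAlgebra c ℓ) where
  open BooleanAlgebra B renaming (⊤ to 𝟏; ⊥ to 𝟎; ¬_ to -_)

  _≤B_ : Carrier → Carrier → Set ℓ
  x ≤B y = (x ∧ y) ≈ x

  _<B_ : Carrier → Carrier → Set ℓ
  x <B y = (x ≤B y) × ¬ (x ≈ y)

  Nontrivial : Set ℓ
  Nontrivial = ¬ (𝟎 ≈ 𝟏)

  record IsModal (f : Carrier → Carrier) : Set (c ⊔ ℓ) where
    field
      cong-f  : ∀ {x y} → x ≈ y → f x ≈ f y
      f-zero  : f 𝟎 ≈ 𝟎
      f-join  : ∀ x y → f (x ∨ y) ≈ (f x ∨ f y)

  dual : (Carrier → Carrier) → Carrier → Carrier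
  dual f x = - f (- x)

  IsUnaryDiscriminator : (Carrier → Carrier) → Set (c ⊔ ℓ)
  IsUnaryDiscriminator g = ∀ x → (x ≈ 𝟎 → g x ≈ 𝟎) × (¬ (x ≈ 𝟎) → g x ≈ 𝟏)

  IsCompanion : (Carrier → Carrier) → (Carrier → Carrier) → Set (c ⊔ ℓ)
  IsCompanion f g = IsModal g × (∀ x → ¬ (x ≈ 𝟎) → (f x ∨ g x) ≈ 𝟏)

  IsProperCompanion : (Carrier → Carrier) → (Carrier → Carrier) → Set (c ⊔ ℓ)
  IsProperCompanion f g = IsCompanion f g × ¬ IsUnaryDiscriminator g

  HasNoProperCompanion : (Carrier → Carrier) → Set (c ⊔ ℓ)
  HasNoProperCompanion f = ¬ (Σ (Carrier → Carrier) λ g → IsProperCompanion f g)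

  IsInf : ∀ {p} → (Carrier → Set p) → Carrier → Set (c ⊔ ℓ ⊔ p)
  IsInf S m = (∀ z → S z → m ≤B z) × (∀ w → (∀ z → S z → w ≤B z) → w ≤B m)

  IsSup : ∀ {p} → (Carrier → Set p) → Carrier → Set (c ⊔ ℓ ⊔ p)
  IsSup S m = (∀ z → S z → z ≤B m) × (∀ w → (∀ z → S z → z ≤B w) → m ≤B w)

  CondB : (Carrier → Carrier) → Set (c ⊔ ℓ)
  CondB f = ∀ x → ¬ (x ≈ 𝟎) →
    IsInf (λ z → ∃ λ y → (𝟎 <B y) × (y ≤B x) × (z ≈ f y)) 𝟎

  CondC : (Carrier → Carrier) → Set (c ⊔ ℓ)
  CondC f = ∀ u → ¬ (u ≈ 𝟏) →
    IsSup (λ z → ∃ λ y → (u ≤B y) × (y <B 𝟏) × (z ≈ dual f y)) 𝟏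

{-# OPTIONS --safe #-}
-- If g is a companion of f and 0 < y ≤ x, then f y ∨ g x ≥ f y ∨ g y = 1, so - g x is a
-- lower bound of { f y : 0 < y ≤ x }; under (b) it is 0, i.e. g is the discriminator.
-- Conversely, a nonzero lower bound w of that set for some x ≠ 0 yields the proper
-- companion that is 0 at 0, - w on (0, x] and 1 elsewhere. Complementation maps
-- { f y : 0 < y ≤ x } onto the complements of { f∂ y : - x ≤ y < 1 }, which turns (b)
-- into (c) and back.
module Submission where

open import Defs
open import Level using (_⊔_; Lift; lift; lower)
open import Algebra.Lattice.Bundles using (BooleanAlgebra)
open import Axiom.ExcludedMiddle using (ExcludedMiddle)
open import Data.Product using (_×_; _,_; proj₁; proj₂; ∃)
open import Data.Empty using (⊥-elim)
open import Function.Bundles using (_⇔_; mk⇔; module Equivalence)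
open import Relation.Binary.Lattice.Bundles using (Lattice)
open import Relation.Nullary using (¬_; yes; no)
open import Relation.Nullary.Decidable using (map′)

lowerExcludedMiddle : ∀ {a} b → ExcludedMiddle (a ⊔ b) → ExcludedMiddle a
lowerExcludedMiddle b em = map′ lower lift (em {Lift b _})

module BooleanAlgebraOrder {c ℓ} (B : BooleanAlgebra c ℓ) where
  open BooleanAlgebra B renaming (⊤ to 𝟏; ⊥ to 𝟎; ¬_ to -_)
  open import Algebra.Lattice.Properties.BooleanAlgebra B
  open import Relation.Binary.Reasoning.Setoid setoid

  infix 4 _≤_ _<_
  _≤_ : Carrier → Carrier → Set ℓ
  _≤_ = _≤B_ B

  _<_ : Carrier → Carrier → Set ℓ
  _<_ = _<B_ B

  -- The library's order on a lattice is  x ≈ x ∧ y , the symmetric form of  _≤_ .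
  private module O = Lattice ∨-∧-orderTheoreticLattice

  ≤-trans : ∀ {x y z} → x ≤ y → y ≤ z → x ≤ z
  ≤-trans x≤y y≤z = sym (O.trans (sym x≤y) (sym y≤z))

  x≤x∨y : ∀ x y → x ≤ x ∨ y
  x≤x∨y x y = sym (O.x≤x∨y x y)

  y≤x∨y : ∀ x y → y ≤ x ∨ y
  y≤x∨y x y = sym (O.y≤x∨y x y)

  ∨-least : ∀ {x y z} → x ≤ z → y ≤ z → x ∨ y ≤ z
  ∨-least x≤z y≤z = sym (O.∨-least (sym x≤z) (sym y≤z))

  ≤-resp-≈ : ∀ {x x′ y y′} → x ≈ x′ → y ≈ y′ → x ≤ y → x′ ≤ y′
  ≤-resp-≈ {x} {x′} {y} {y′} x≈x′ y≈y′ x≤y = begin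
    x′ ∧ y′ ≈⟨ ∧-cong x≈x′ y≈y′ ⟨
    x ∧ y   ≈⟨ x≤y ⟩
    x       ≈⟨ x≈x′ ⟩
    x′      ∎

  ≤-reflexive : ∀ {x y} → x ≈ y → x ≤ y
  ≤-reflexive {x} x≈y = ≤-resp-≈ refl x≈y (∧-idem x)

  𝟎≤ : ∀ x → 𝟎 ≤ x
  𝟎≤ = ∧-zeroˡ

  ≤𝟏 : ∀ x → x ≤ 𝟏
  ≤𝟏 = ∧-identityʳ

  ≤𝟎⇒≈𝟎 : ∀ {x} → x ≤ 𝟎 → x ≈ 𝟎
  ≤𝟎⇒≈𝟎 {x} x≤𝟎 = trans (sym x≤𝟎) (∧-zeroʳ x)

  ≈𝟎⇒≤ : ∀ {x y} → x ≈ 𝟎 → x ≤ y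
  ≈𝟎⇒≤ x≈𝟎 = ≤-resp-≈ (sym x≈𝟎) refl (𝟎≤ _)

  ≉𝟎⇒∨≉𝟎 : ∀ {x y} → ¬ x ≈ 𝟎 → ¬ x ∨ y ≈ 𝟎
  ≉𝟎⇒∨≉𝟎 {x} {y} x≉𝟎 x∨y≈𝟎 = x≉𝟎 (≤𝟎⇒≈𝟎 (≤-resp-≈ refl x∨y≈𝟎 (x≤x∨y x y)))

  𝟏≤⇒≈𝟏 : ∀ {x} → 𝟏 ≤ x → x ≈ 𝟏
  𝟏≤⇒≈𝟏 {x} 𝟏≤x = trans (sym (∧-identityˡ x)) 𝟏≤x

  ≤⇒∨≈ : ∀ {x y} → x ≤ y → x ∨ y ≈ y
  ≤⇒∨≈ {x} {y} x≤y = begin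
    x ∨ y       ≈⟨ ∨-congʳ x≤y ⟨
    x ∧ y ∨ y   ≈⟨ ∨-congʳ (∧-comm x y) ⟩
    y ∧ x ∨ y   ≈⟨ ∨-comm _ y ⟩
    y ∨ y ∧ x   ≈⟨ ∨-absorbs-∧ y x ⟩
    y           ∎

  ≉𝟎⇒𝟎< : ∀ {x} → ¬ x ≈ 𝟎 → 𝟎 < x
  ≉𝟎⇒𝟎< x≉𝟎 = 𝟎≤ _ , λ 𝟎≈x → x≉𝟎 (sym 𝟎≈x)

  ≉𝟏⇒<𝟏 : ∀ {x} → ¬ x ≈ 𝟏 → x < 𝟏
  ≉𝟏⇒<𝟏 x≉𝟏 = ≤𝟏 _ , x≉𝟏

  ¬-antitone : ∀ {x y} → x ≤ y → - y ≤ - x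
  ¬-antitone {x} {y} x≤y = begin
    - y ∧ - x   ≈⟨ deMorgan₂ y x ⟨
    - (y ∨ x)   ≈⟨ ¬-cong (trans (∨-comm y x) (≤⇒∨≈ x≤y)) ⟩
    - y         ∎

  ¬≤-swap : ∀ {x y} → - x ≤ y → - y ≤ x
  ¬≤-swap ¬x≤y = ≤-resp-≈ refl (¬-involutive _) (¬-antitone ¬x≤y)

  ≤¬-swap : ∀ {x y} → x ≤ - y → y ≤ - x
  ≤¬-swap x≤¬y = ≤-resp-≈ (¬-involutive _) refl (¬-antitone x≤¬y)

  ¬≈𝟏⇒≈𝟎 : ∀ {x} → - x ≈ 𝟏 → x ≈ 𝟎
  ¬≈𝟏⇒≈𝟎 {x} ¬x≈𝟏 = begin
    x       ≈⟨ ¬-involutive x ⟨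
    - - x   ≈⟨ ¬-cong ¬x≈𝟏 ⟩
    - 𝟏     ≈⟨ ¬⊤≈⊥ ⟩
    𝟎       ∎

  ¬≈𝟎⇒≈𝟏 : ∀ {x} → - x ≈ 𝟎 → x ≈ 𝟏
  ¬≈𝟎⇒≈𝟏 {x} ¬x≈𝟎 = begin
    x       ≈⟨ ¬-involutive x ⟨
    - - x   ≈⟨ ¬-cong ¬x≈𝟎 ⟩
    - 𝟎     ≈⟨ ¬⊥≈⊤ ⟩
    𝟏       ∎

  ∨≈𝟏⇒¬≤ : ∀ {x y} → x ∨ y ≈ 𝟏 → - y ≤ x
  ∨≈𝟏⇒¬≤ {x} {y} x∨y≈𝟏 = sym (begin
    - y                   ≈⟨ ∧-identityʳ _ ⟨
    - y ∧ 𝟏               ≈⟨ ∧-congˡ x∨y≈𝟏 ⟨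
    - y ∧ (x ∨ y)         ≈⟨ ∧-distribˡ-∨ _ _ _ ⟩
    - y ∧ x ∨ - y ∧ y     ≈⟨ ∨-congˡ (∧-complementˡ y) ⟩
    - y ∧ x ∨ 𝟎           ≈⟨ ∨-identityʳ _ ⟩
    - y ∧ x               ∎)

  ≤⇒∨¬≈𝟏 : ∀ {x y} → x ≤ y → y ∨ - x ≈ 𝟏
  ≤⇒∨¬≈𝟏 {x} {y} x≤y = begin
    y ∨ - x           ≈⟨ ∨-congʳ (≤⇒∨≈ x≤y) ⟨
    (x ∨ y) ∨ - x     ≈⟨ ∨-congʳ (∨-comm x y) ⟩
    (y ∨ x) ∨ - x     ≈⟨ ∨-assoc y x (- x) ⟩
    y ∨ (x ∨ - x)     ≈⟨ ∨-congˡ (∨-complementʳ x) ⟩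
    y ∨ 𝟏             ≈⟨ ∨-zeroʳ y ⟩
    𝟏                 ∎

  modal-monotone : ∀ {h} → IsModal B h → ∀ {x y} → x ≤ y → h x ≤ h y
  modal-monotone {h} h-modal {x} {y} x≤y =
    ≤-resp-≈ refl hx∨hy≈hy (x≤x∨y (h x) (h y))
    where
    open IsModal h-modal
    hx∨hy≈hy : h x ∨ h y ≈ h y
    hx∨hy≈hy = trans (sym (f-join x y)) (cong-f (≤⇒∨≈ x≤y))

  LowerBound : ∀ {p} → (Carrier → Set p) → Carrier → Set (c ⊔ ℓ ⊔ p)
  LowerBound S w = ∀ z → S z → w ≤ z

  UpperBound : ∀ {p} → (Carrier → Set p) → Carrier → Set (c ⊔ ℓ ⊔ p)
  UpperBound S w = ∀ z → S z → z ≤ w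

  isInf-𝟎⇔ : ∀ {p} {S : Carrier → Set p} → IsInf B S 𝟎 ⇔ (∀ w → LowerBound S w → w ≈ 𝟎)
  isInf-𝟎⇔ = mk⇔
    (λ inf w w-lb → ≤𝟎⇒≈𝟎 (proj₂ inf w w-lb))
    (λ only𝟎 → (λ z _ → 𝟎≤ z) , λ w w-lb → ≤-reflexive (only𝟎 w w-lb))

  isSup-𝟏⇔ : ∀ {p} {S : Carrier → Set p} → IsSup B S 𝟏 ⇔ (∀ w → UpperBound S w → w ≈ 𝟏)
  isSup-𝟏⇔ = mk⇔
    (λ sup w w-ub → 𝟏≤⇒≈𝟏 (proj₂ sup w w-ub))
    (λ only𝟏 → (λ z _ → ≤𝟏 z) , λ w w-ub → ≤-reflexive (sym (only𝟏 w w-ub)))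

module StepOperator {c ℓ} (em : ExcludedMiddle (c ⊔ ℓ)) (B : BooleanAlgebra c ℓ)
  (x a : BooleanAlgebra.Carrier B) where
  open BooleanAlgebra B renaming (⊤ to 𝟏; ⊥ to 𝟎; ¬_ to -_)
  open import Algebra.Lattice.Properties.BooleanAlgebra B
  open import Relation.Binary.Reasoning.Setoid setoid
  open BooleanAlgebraOrder B

  data Region (z : Carrier) : Set ℓ where
    null    : z ≈ 𝟎 → Region z
    inside  : ¬ z ≈ 𝟎 → z ≤ x → Region z
    outside : ¬ z ≤ x → Region z

  region : ∀ z → Region z
  region z with lowerExcludedMiddle c em {z ≈ 𝟎} | lowerExcludedMiddle c em {z ≤ x}
  ... | yes z≈𝟎 | _       = null z≈𝟎
  ... | no z≉𝟎  | yes z≤x = inside z≉𝟎 z≤x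
  ... | no _    | no z≰x  = outside z≰x

  step : Carrier → Carrier
  step z with region z
  ... | null _     = 𝟎
  ... | inside _ _ = a
  ... | outside _  = 𝟏

  step-null : ∀ {z} → z ≈ 𝟎 → step z ≈ 𝟎
  step-null {z} z≈𝟎 with region z
  ... | null _        = refl
  ... | inside z≉𝟎 _  = ⊥-elim (z≉𝟎 z≈𝟎)
  ... | outside z≰x   = ⊥-elim (z≰x (≈𝟎⇒≤ z≈𝟎))

  step-inside : ∀ {z} → ¬ z ≈ 𝟎 → z ≤ x → step z ≈ a
  step-inside {z} z≉𝟎 z≤x with region z
  ... | null z≈𝟎    = ⊥-elim (z≉𝟎 z≈𝟎)
  ... | inside _ _  = refl
  ... | outside z≰x = ⊥-elim (z≰x z≤x)

  step-outside : ∀ {z} → ¬ z ≤ x → step z ≈ 𝟏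
  step-outside {z} z≰x with region z
  ... | null z≈𝟎     = ⊥-elim (z≰x (≈𝟎⇒≤ z≈𝟎))
  ... | inside _ z≤x = ⊥-elim (z≰x z≤x)
  ... | outside _    = refl

  step-cong : ∀ {z z′} → z ≈ z′ → step z ≈ step z′
  step-cong {z} {z′} z≈z′ with region z
  ... | null z≈𝟎       = sym (step-null (trans (sym z≈z′) z≈𝟎))
  ... | inside z≉𝟎 z≤x = sym (step-inside (λ z′≈𝟎 → z≉𝟎 (trans z≈z′ z′≈𝟎)) (≤-resp-≈ z≈z′ refl z≤x))
  ... | outside z≰x    = sym (step-outside (λ z′≤x → z≰x (≤-resp-≈ (sym z≈z′) refl z′≤x)))

  step-join : ∀ z z′ → step (z ∨ z′) ≈ step z ∨ step z′
  step-join z z′ with region z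
  ... | null z≈𝟎 = begin
    step (z ∨ z′)  ≈⟨ step-cong (trans (∨-congʳ z≈𝟎) (∨-identityˡ z′)) ⟩
    step z′        ≈⟨ ∨-identityˡ _ ⟨
    𝟎 ∨ step z′    ∎
  ... | outside z≰x = begin
    step (z ∨ z′)  ≈⟨ step-outside (λ z∨z′≤x → z≰x (≤-trans (x≤x∨y z z′) z∨z′≤x)) ⟩
    𝟏              ≈⟨ ∨-zeroˡ _ ⟨
    𝟏 ∨ step z′    ∎
  ... | inside z≉𝟎 z≤x with region z′
  ...   | null z′≈𝟎 = begin
    step (z ∨ z′)  ≈⟨ step-inside (≉𝟎⇒∨≉𝟎 z≉𝟎) (∨-least z≤x (≈𝟎⇒≤ z′≈𝟎)) ⟩
    a              ≈⟨ ∨-identityʳ a ⟨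
    a ∨ 𝟎          ∎
  ...   | inside _ z′≤x = begin
    step (z ∨ z′)  ≈⟨ step-inside (≉𝟎⇒∨≉𝟎 z≉𝟎) (∨-least z≤x z′≤x) ⟩
    a              ≈⟨ ∨-idem a ⟨
    a ∨ a          ∎
  ...   | outside z′≰x = begin
    step (z ∨ z′)  ≈⟨ step-outside (λ z∨z′≤x → z′≰x (≤-trans (y≤x∨y z z′) z∨z′≤x)) ⟩
    𝟏              ≈⟨ ∨-zeroʳ a ⟨
    a ∨ 𝟏          ∎

  step-isModal : IsModal B step
  step-isModal = record { cong-f = step-cong ; f-zero = step-null refl ; f-join = step-join }

module ModalOperator {c ℓ} (B : BooleanAlgebra c ℓ)
  (f : BooleanAlgebra.Carrier B → BooleanAlgebra.Carrier B) where
  open BooleanAlgebra B renaming (⊤ to 𝟏; ⊥ to 𝟎; ¬_ to -_)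
  open import Algebra.Lattice.Properties.BooleanAlgebra B
  open import Relation.Binary.Reasoning.Setoid setoid
  open BooleanAlgebraOrder B
  open Equivalence

  ImageBelow : Carrier → Carrier → Set (c ⊔ ℓ)
  ImageBelow x z = ∃ λ y → 𝟎 < y × y ≤ x × z ≈ f y

  DualImageAbove : Carrier → Carrier → Set (c ⊔ ℓ)
  DualImageAbove u z = ∃ λ y → u ≤ y × y < 𝟏 × z ≈ dual B f y

  companion-covers : ∀ {g} → IsCompanion B f g → ∀ {x y} → 𝟎 < y → y ≤ x → f y ∨ g x ≈ 𝟏
  companion-covers {g} (g-modal , covers) {x} {y} (_ , 𝟎≉y) y≤x = begin
    f y ∨ g x          ≈⟨ ∨-congˡ (≤⇒∨≈ (modal-monotone g-modal y≤x)) ⟨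
    f y ∨ (g y ∨ g x)  ≈⟨ ∨-assoc _ _ _ ⟨
    (f y ∨ g y) ∨ g x  ≈⟨ ∨-congʳ (covers y (λ y≈𝟎 → 𝟎≉y (sym y≈𝟎))) ⟩
    𝟏 ∨ g x            ≈⟨ ∨-zeroˡ _ ⟩
    𝟏                  ∎

  condB⇒companion-discriminator : ∀ {g} → CondB B f → IsCompanion B f g → IsUnaryDiscriminator B g
  condB⇒companion-discriminator {g} condB companion x =
    (λ x≈𝟎 → trans (cong-f x≈𝟎) f-zero) ,
    (λ x≉𝟎 → ¬≈𝟎⇒≈𝟏 (to isInf-𝟎⇔ (condB x x≉𝟎) (- g x) ¬gx-lowerBound))
    where
    open IsModal (proj₁ companion)
    ¬gx-lowerBound : LowerBound (ImageBelow x) (- g x)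
    ¬gx-lowerBound z (y , 𝟎<y , y≤x , z≈fy) =
      ≤-resp-≈ refl (sym z≈fy) (∨≈𝟏⇒¬≤ (companion-covers companion 𝟎<y y≤x))

  condB⇒noProperCompanion : CondB B f → HasNoProperCompanion B f
  condB⇒noProperCompanion condB (g , companion , notDiscriminator) =
    notDiscriminator (condB⇒companion-discriminator condB companion)

  module _ (em : ExcludedMiddle (c ⊔ ℓ)) {x w : Carrier} where
    open StepOperator em B x (- w)

    lowerBound⇒properCompanion : ¬ x ≈ 𝟎 → ¬ w ≈ 𝟎 → LowerBound (ImageBelow x) w →
                                 IsProperCompanion B f step
    lowerBound⇒properCompanion x≉𝟎 w≉𝟎 w-lowerBound = (step-isModal , covers) , notDiscriminator
      where
      covers : ∀ z → ¬ z ≈ 𝟎 → f z ∨ step z ≈ 𝟏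
      covers z z≉𝟎 with region z
      ... | null z≈𝟎     = ⊥-elim (z≉𝟎 z≈𝟎)
      ... | inside _ z≤x = ≤⇒∨¬≈𝟏 (w-lowerBound (f z) (z , ≉𝟎⇒𝟎< z≉𝟎 , z≤x , refl))
      ... | outside _    = ∨-zeroʳ (f z)

      notDiscriminator : ¬ IsUnaryDiscriminator B step
      notDiscriminator discriminator =
        w≉𝟎 (¬≈𝟏⇒≈𝟎 (trans (sym (step-inside x≉𝟎 (≤-reflexive refl))) (proj₂ (discriminator x) x≉𝟎)))

  noProperCompanion⇒condB : ExcludedMiddle (c ⊔ ℓ) → HasNoProperCompanion B f → CondB B f
  noProperCompanion⇒condB em noProper x x≉𝟎 = from isInf-𝟎⇔ only𝟎
    where
    only𝟎 : ∀ w → LowerBound (ImageBelow x) w → w ≈ 𝟎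
    only𝟎 w w-lowerBound with lowerExcludedMiddle c em {w ≈ 𝟎}
    ... | yes w≈𝟎 = w≈𝟎
    ... | no w≉𝟎  = ⊥-elim (noProper (_ , lowerBound⇒properCompanion em x≉𝟎 w≉𝟎 w-lowerBound))

  module _ (f-modal : IsModal B f) where
    open IsModal f-modal

    lowerBound⇒¬upperBound : ∀ {x w} → LowerBound (ImageBelow x) w → UpperBound (DualImageAbove (- x)) (- w)
    lowerBound⇒¬upperBound w-lowerBound z (y , ¬x≤y , (_ , y≉𝟏) , z≈f∂y) =
      ≤-resp-≈ (sym z≈f∂y) refl
        (¬-antitone (w-lowerBound (f (- y)) (- y , ≉𝟎⇒𝟎< (λ ¬y≈𝟎 → y≉𝟏 (¬≈𝟎⇒≈𝟏 ¬y≈𝟎)) , ¬≤-swap ¬x≤y , refl)))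

    upperBound⇒¬lowerBound : ∀ {u w} → UpperBound (DualImageAbove u) w → LowerBound (ImageBelow (- u)) (- w)
    upperBound⇒¬lowerBound {u} {w} w-upperBound z (y , (_ , 𝟎≉y) , y≤¬u , z≈fy) =
      ≤-resp-≈ refl f[--y]≈z
        (¬-antitone (w-upperBound (dual B f (- y)) (- y , ≤¬-swap y≤¬u , ≉𝟏⇒<𝟏 ¬y≉𝟏 , refl)))
      where
      ¬y≉𝟏 : ¬ - y ≈ 𝟏
      ¬y≉𝟏 ¬y≈𝟏 = 𝟎≉y (sym (¬≈𝟏⇒≈𝟎 ¬y≈𝟏))
      f[--y]≈z : - dual B f (- y) ≈ z
      f[--y]≈z = begin
        - - f (- - y)  ≈⟨ ¬-involutive _ ⟩
        f (- - y)      ≈⟨ cong-f (¬-involutive y) ⟩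
        f y            ≈⟨ z≈fy ⟨
        z              ∎

    condB⇒condC : CondB B f → CondC B f
    condB⇒condC condB u u≉𝟏 = from isSup-𝟏⇔ λ w w-upperBound →
      ¬≈𝟎⇒≈𝟏 (to isInf-𝟎⇔ (condB (- u) (λ ¬u≈𝟎 → u≉𝟏 (¬≈𝟎⇒≈𝟏 ¬u≈𝟎))) (- w) (upperBound⇒¬lowerBound w-upperBound))

    condC⇒condB : CondC B f → CondB B f
    condC⇒condB condC x x≉𝟎 = from isInf-𝟎⇔ λ w w-lowerBound →
      ¬≈𝟏⇒≈𝟎 (to isSup-𝟏⇔ (condC (- x) (λ ¬x≈𝟏 → x≉𝟎 (¬≈𝟏⇒≈𝟎 ¬x≈𝟏))) (- w) (lowerBound⇒¬upperBound w-lowerBound))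

mainTheorem16 : ∀ {c ℓ} → ExcludedMiddle (c ⊔ ℓ) → (B : BooleanAlgebra c ℓ) →
    Nontrivial B → (f : BooleanAlgebra.Carrier B → BooleanAlgebra.Carrier B) →
    IsModal B f →
    ((HasNoProperCompanion B f ⇔ CondB B f) × (CondB B f ⇔ CondC B f))
mainTheorem16 em B _ f f-modal =
  mk⇔ (noProperCompanion⇒condB em) condB⇒noProperCompanion ,
  mk⇔ (condB⇒condC f-modal) (condC⇒condB f-modal)
  where open ModalOperator B f
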